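{- Let $x \geq 4$ be even. On the point set $\mathbb{Z}_{x-1} \cup \{\infty\}$ let $C_0 = (c_1,\dots,c_x) = (\infty, 0, x-2, 1, x-3, 2, x-4, \dots, \tfrac{x}{2}, \tfrac{x-2}{2})$, i.e. $c_1 = \infty$, $c_k = k - \frac{k+2}{2}$ for even $k$ and $c_k = x - \frac{k+1}{2}$ for odd $k \geq 3$. For $m \in \mathbb{Z}$ let $C_m$ be obtained from $C_0$ by adding $m$ modulo $x-1$ to every finite entry ($\infty + m = \infty$). For $j \in \{0,1,\dots,x-2\}$ let $T_j$ correspond to the cycle $D_j = C_{j(x-2)/2}$ (subscript mod $x-1$), written $D_j = (c^{(j)}_1,\dots,c^{(j)}_x)$, and let $t_{j,l} = (c^{(j)}_l, c^{(j)}_{l+1})$ (with $c^{(j)}_{x+1} = c^{(j)}_1$) be the index of column $l$ of $T_j$, i.e. the $l$-th edge of $D_j$. Then for every $j \in \{0,\dots,x-2\}$ (with $j+1$ taken mod $x-1$) and every $l \in \{2,4,\dots,x-2\}$ we have $t_{j,l} = t_{j+1,x-l+1}$.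
   Context: The cycles $C_0,\dots,C_{x-2}$ are Hamilton cycles on $\mathbb{Z}_{x-1}\cup\{\infty\}$; each matrix $T_j$ has its $x$ columns indexed, in order, by the consecutive (ordered) edges of the cycle $D_j$. -}

module Defs where

open import Data.Nat using (ℕ; zero; suc; _+_; _*_; _∸_; _≡ᵇ_)
open import Data.Nat.DivMod using (_/_; _%_)
open import Data.Maybe using (Maybe; just; nothing; map)
open import Data.Bool using (if_then_else_)
open import Data.Product using (_×_; _,_)

-- Points of ℤ_{x-1} ∪ {∞}: nothing = ∞, just a = residue a (kept in 0..x-2).
Point : Set
Point = Maybe ℕ

-- The modulus x - 1, written as suc (x ∸ 2) so that Agda sees it is nonzero;
-- for x ≥ 2 (in particular x ≥ 4) this equals x - 1.
modulus : ℕ → ℕ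
modulus x = suc (x ∸ 2)

c0 : (x : ℕ) → ℕ → Point
c0 x 1 = nothing
c0 x k = if (k % 2 ≡ᵇ 0) then just (k ∸ ((k + 2) / 2)) else just (x ∸ ((k + 1) / 2))

C : (x m k : ℕ) → Point
C x m k = map (λ a → (a + m) % modulus x) (c0 x k)

-- D_j = C_{j(x-2)/2}  (the subscript only matters mod x-1, handled by C).
D : (x j k : ℕ) → Point
D x j k = C x (j * (x ∸ 2) / 2) k

nextPos : (x l : ℕ) → ℕ
nextPos x l = if (l ≡ᵇ x) then 1 else suc l

t : (x j l : ℕ) → Point × Point
t x j l = D x j l , D x j (nextPos x l)

-- Write x = 2(B + 1), so that x - 1 = 2B + 1 and D_j = C_{jB}.  Position 2q + 2 of C_0
-- carries q and position 2q + 3 carries x - (q + 2).  For l = 2u + 2 we have x - l + 1 = 2r + 3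
-- with B = u + r + 1, so t_{j,l} = (u, B + r + 1) + jB and t_{j+1,x-l+1} = (B + u + 1, r + 1) + (j + 1)B:
-- the end vertices agree on the nose and the start vertices differ by 2B + 1 ≡ 0.
module Submission where

open import Defs
open import Data.Nat using (ℕ; _+_; _∸_; _≤_)
open import Data.Nat.DivMod using (_%_)
open import Data.Nat.Divisibility using (_∣_)
open import Relation.Binary.PropositionalEquality using (_≡_)

open import Data.Nat using (zero; suc; _*_; _/_; _<_; _≡ᵇ_; s≤s; NonZero)
open import Data.Nat.Properties using (+-comm; *-assoc; m≤m+n; m+n∸m≡n; *-cancelʳ-≤; m≤n⇒∃[o]m+o≡n)
open import Data.Nat.DivMod using (m*n%n≡0; [m+kn]%n≡m%n; [m+n]%n≡m%n; m*n/n≡m; m%n%n≡m%n; %-distribˡ-+; %-distribˡ-*)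
open import Data.Nat.Divisibility using (divides)
open import Data.Nat.Tactic.RingSolver using (solve-∀)
open import Data.Bool using (false)
open import Data.Maybe using (just; nothing)
open import Data.Product using (_×_; _,_)
open import Relation.Binary.PropositionalEquality using (refl; sym; trans; subst; cong; cong₂; module ≡-Reasoning)

%-cong-+ˡ : ∀ a {m n} d .{{_ : NonZero d}} → m % d ≡ n % d → (a + m) % d ≡ (a + n) % d
%-cong-+ˡ a {m} {n} d m≡n = begin
  (a + m) % d             ≡⟨ %-distribˡ-+ a m d ⟩
  (a % d + m % d) % d     ≡⟨ cong (λ v → (a % d + v) % d) m≡n ⟩
  (a % d + n % d) % d     ≡⟨ sym (%-distribˡ-+ a n d) ⟩
  (a + n) % d             ∎
  where open ≡-Reasoning

%-cong-*ʳ : ∀ {m n} b d .{{_ : NonZero d}} → m % d ≡ n % d → (m * b) % d ≡ (n * b) % d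
%-cong-*ʳ {m} {n} b d m≡n = begin
  (m * b) % d             ≡⟨ %-distribˡ-* m b d ⟩
  (m % d * (b % d)) % d   ≡⟨ cong (λ v → (v * (b % d)) % d) m≡n ⟩
  (n % d * (b % d)) % d   ≡⟨ sym (%-distribˡ-* n b d) ⟩
  (n * b) % d             ∎
  where open ≡-Reasoning

m≡1+n+o⇒n<m : ∀ {m n o} → m ≡ suc n + o → n < m
m≡1+n+o⇒n<m {n = n} {o} m≡ = subst (n <_) (sym m≡) (s≤s (m≤m+n n o))

m≡n+o⇒m∸n≡o : ∀ {m} n {o} → m ≡ n + o → m ∸ n ≡ o
m≡n+o⇒m∸n≡o {m} n {o} m≡ = trans (cong (_∸ n) m≡) (m+n∸m≡n n o)

c0-even : ∀ x q → c0 x (suc q * 2) ≡ just q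
c0-even x q rewrite m*n%n≡0 (suc q) 2 {{_}} = cong just (begin
  suc q * 2 ∸ (suc q * 2 + 2) / 2   ≡⟨ cong (λ v → suc q * 2 ∸ v / 2) (2q+4≡[q+2]*2 q) ⟩
  suc q * 2 ∸ (q + 2) * 2 / 2       ≡⟨ cong (suc q * 2 ∸_) (m*n/n≡m (q + 2) 2) ⟩
  suc q * 2 ∸ (q + 2)               ≡⟨ cong (_∸ (q + 2)) (2q+2≡[q+2]+q q) ⟩
  (q + 2) + q ∸ (q + 2)             ≡⟨ m+n∸m≡n (q + 2) q ⟩
  q                                 ∎)
  where
  open ≡-Reasoning
  2q+4≡[q+2]*2 : ∀ q → suc q * 2 + 2 ≡ (q + 2) * 2
  2q+4≡[q+2]*2 = solve-∀
  2q+2≡[q+2]+q : ∀ q → suc q * 2 ≡ (q + 2) + q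
  2q+2≡[q+2]+q = solve-∀

c0-odd : ∀ x q → c0 x (suc (suc q * 2)) ≡ just (x ∸ (q + 2))
c0-odd x q rewrite [m+kn]%n≡m%n 1 (suc q) 2 {{_}} =
  cong (λ v → just (x ∸ v)) (trans (cong (_/ 2) (2q+4≡[q+2]*2 q)) (m*n/n≡m (q + 2) 2))
  where
  2q+4≡[q+2]*2 : ∀ q → suc (suc q * 2) + 1 ≡ (q + 2) * 2
  2q+4≡[q+2]*2 = solve-∀

C-just : ∀ x m k {v} → c0 x k ≡ just v → C x m k ≡ just ((v + m) % modulus x)
C-just x m k c0≡v rewrite c0≡v = refl

C-cong-% : ∀ x k {m n} → m % modulus x ≡ n % modulus x → C x m k ≡ C x n k
C-cong-% x k m≡n with c0 x k
... | nothing = refl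
... | just a  = cong just (%-cong-+ˡ a (modulus x) m≡n)

<⇒≡ᵇ-false : ∀ {m n} → m < n → (m ≡ᵇ n) ≡ false
<⇒≡ᵇ-false {zero}  {suc n} _         = refl
<⇒≡ᵇ-false {suc m} {suc n} (s≤s m<n) = <⇒≡ᵇ-false m<n

nextPos-< : ∀ {x l} → l < x → nextPos x l ≡ suc l
nextPos-< {x} {l} l<x rewrite <⇒≡ᵇ-false l<x = refl

edge : (x m l : ℕ) → Point × Point
edge x m l = C x m l , C x m (nextPos x l)

edge-cong-% : ∀ x l {m n} → m % modulus x ≡ n % modulus x → edge x m l ≡ edge x n l
edge-cong-% x l m≡n = cong₂ _,_ (C-cong-% x l m≡n) (C-cong-% x (nextPos x l) m≡n)

edge-even : ∀ x m q → suc q * 2 < x →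
            edge x m (suc q * 2) ≡ (just ((q + m) % modulus x) , just ((x ∸ (q + 2) + m) % modulus x))
edge-even x m q l<x rewrite nextPos-< l<x =
  cong₂ _,_ (C-just x m (suc q * 2) (c0-even x q))
            (C-just x m (suc (suc q * 2)) (c0-odd x q))

edge-odd : ∀ x m q → suc (suc q * 2) < x →
           edge x m (suc (suc q * 2)) ≡ (just ((x ∸ (q + 2) + m) % modulus x) , just ((suc q + m) % modulus x))
edge-odd x m q l<x rewrite nextPos-< l<x =
  cong₂ _,_ (C-just x m (suc (suc q * 2)) (c0-odd x q))
            (C-just x m (suc (suc q) * 2) (c0-even x (suc q)))

t≡edge : ∀ B j l → t (suc B * 2) j l ≡ edge (suc B * 2) (j * B) l
t≡edge B j l = cong (λ m → edge (suc B * 2) m l)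
                    (trans (cong (_/ 2) (sym (*-assoc j B 2))) (m*n/n≡m (j * B) 2))

t-%-modulus : ∀ B j l → t (suc B * 2) (j % modulus (suc B * 2)) l ≡ t (suc B * 2) j l
t-%-modulus B j l = begin
  t x (j % N) l         ≡⟨ t≡edge B (j % N) l ⟩
  edge x (j % N * B) l  ≡⟨ edge-cong-% x l (%-cong-*ʳ {j % N} {j} B N (m%n%n≡m%n j N)) ⟩
  edge x (j * B) l      ≡⟨ sym (t≡edge B j l) ⟩
  t x j l               ∎
  where
  open ≡-Reasoning
  x : ℕ
  x = suc B * 2
  N : ℕ
  N = modulus x

t-reflect : ∀ u r j → let x = suc (suc (u + r)) * 2 in
            t x j (suc u * 2) ≡ t x (j + 1) (suc (suc r * 2))
t-reflect u r j = begin
  t x j (suc u * 2)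
    ≡⟨ t≡edge B j (suc u * 2) ⟩
  edge x (j * B) (suc u * 2)
    ≡⟨ edge-even x (j * B) u (m≡1+n+o⇒n<m (x≡2u+3+2r u r)) ⟩
  (just ((u + j * B) % N) , just ((x ∸ (u + 2) + j * B) % N))
    ≡⟨ cong₂ (λ a b → just a , just b) start≡ end≡ ⟩
  (just ((x ∸ (r + 2) + (j + 1) * B) % N) , just ((suc r + (j + 1) * B) % N))
    ≡⟨ sym (edge-odd x ((j + 1) * B) r (m≡1+n+o⇒n<m (x≡2r+4+2u u r))) ⟩
  edge x ((j + 1) * B) (suc (suc r * 2))
    ≡⟨ sym (t≡edge B (j + 1) (suc (suc r * 2))) ⟩
  t x (j + 1) (suc (suc r * 2)) ∎
  where
  open ≡-Reasoning
  B : ℕ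
  B = suc (u + r)
  x : ℕ
  x = suc B * 2
  N : ℕ
  N = modulus x
  x≡2u+3+2r : ∀ u r → suc (suc (u + r)) * 2 ≡ suc (suc u * 2) + suc (r * 2)
  x≡2u+3+2r = solve-∀
  x≡2r+4+2u : ∀ u r → suc (suc (u + r)) * 2 ≡ suc (suc (suc r * 2)) + u * 2
  x≡2r+4+2u = solve-∀
  start≡ : (u + j * B) % N ≡ (x ∸ (r + 2) + (j + 1) * B) % N
  start≡ = sym (begin
    (x ∸ (r + 2) + (j + 1) * B) % N
      ≡⟨ cong (λ v → (v + (j + 1) * B) % N) (m≡n+o⇒m∸n≡o (r + 2) (eq u r)) ⟩
    (B + suc u + (j + 1) * B) % N   ≡⟨ cong (_% N) (eq′ u r j) ⟩
    (u + j * B + N) % N             ≡⟨ [m+n]%n≡m%n (u + j * B) N ⟩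
    (u + j * B) % N                 ∎)
    where
    eq : ∀ u r → suc (suc (u + r)) * 2 ≡ (r + 2) + (suc (u + r) + suc u)
    eq = solve-∀
    eq′ : ∀ u r j → suc (u + r) + suc u + (j + 1) * suc (u + r)
                  ≡ u + j * suc (u + r) + suc (suc (u + r) * 2)
    eq′ = solve-∀
  end≡ : (x ∸ (u + 2) + j * B) % N ≡ (suc r + (j + 1) * B) % N
  end≡ = cong (_% N) (begin
    x ∸ (u + 2) + j * B       ≡⟨ cong (_+ j * B) (m≡n+o⇒m∸n≡o (u + 2) (eq u r)) ⟩
    B + suc r + j * B         ≡⟨ eq′ u r j ⟩
    suc r + (j + 1) * B       ∎)
    where
    eq : ∀ u r → suc (suc (u + r)) * 2 ≡ (u + 2) + (suc (u + r) + suc r)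
    eq = solve-∀
    eq′ : ∀ u r j → suc (u + r) + suc r + j * suc (u + r) ≡ suc r + (j + 1) * suc (u + r)
    eq′ = solve-∀

reflected-position : ∀ u r → suc (suc (u + r)) * 2 ∸ suc u * 2 + 1 ≡ suc (suc r * 2)
reflected-position u r =
  trans (cong (_+ 1) (m≡n+o⇒m∸n≡o (suc u * 2) (x≡ u r))) (+-comm (suc r * 2) 1)
  where
  x≡ : ∀ u r → suc (suc (u + r)) * 2 ≡ suc u * 2 + suc r * 2
  x≡ = solve-∀

lemma6 : (x : ℕ) → 4 ≤ x → 2 ∣ x →
         (j : ℕ) → j ≤ x ∸ 2 →
         (l : ℕ) → 2 ∣ l → 2 ≤ l → l ≤ x ∸ 2 →
         t x j l ≡ t x ((j + 1) % modulus x) (x ∸ l + 1)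
lemma6 _ _ (divides zero refl) _ _ _ (divides (suc u) refl) _ ()
lemma6 _ _ (divides _ refl) _ _ _ (divides zero refl) () _
lemma6 _ _ (divides (suc B) refl) j _ _ (divides (suc u) refl) _ l≤x∸2
  with m≤n⇒∃[o]m+o≡n (*-cancelʳ-≤ (suc u) B 2 l≤x∸2)
... | r , refl = begin
  t x j (suc u * 2)                ≡⟨ t-reflect u r j ⟩
  t x (j + 1) (suc (suc r * 2))    ≡⟨ sym (t-%-modulus B (j + 1) (suc (suc r * 2))) ⟩
  t x j′ (suc (suc r * 2))         ≡⟨ cong (t x j′) (sym (reflected-position u r)) ⟩
  t x j′ (x ∸ suc u * 2 + 1)       ∎
  where
  open ≡-Reasoning
  x : ℕ
  x = suc B * 2
  j′ : ℕ
  j′ = (j + 1) % modulus x
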